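{- Let $G$ be a graph isomorphic to one of $C_5$, the bull, the gem, the co-gem. Let $(A,B)$ be a partition of $V(G)$ into two sets (with $A$ possibly empty) with $|A|<|B|$, and let $H=G\oplus\mathcal{P}$ for some $\mathcal{P}\subseteq\{(A,A),(B,B)\}$. If $H$ has at least two isolated vertices, then either (1) $G$ is the co-gem, $A$ consists of the isolated vertex of $G$ and one of the vertices of degree $1$, and $\mathcal{P}=\{(B,B)\}$; or (2) $G$ is the co-gem, $A$ consists of one of the vertices of degree $1$ and its neighbor, and $\mathcal{P}=\{(A,A)\}$. Moreover, in these cases $H$ has exactly two isolated vertices.
   Context: All graphs are finite, simple. For $A,B\subseteq V(G)$, $G\oplus(A,B)$ is the graph on $V(G)$ in which the adjacency of distinct $u,v$ is toggled exactly when $(u,v)\in(A\times B)\cup(B\times A)$ (so $G\oplus(A,A)$ complements the subgraph induced on $A$); $G\oplus\mathcal{P}$ applies all flips in $\mathcal{P}$. $C_5$ is the 5-cycle; with $abcd$ an induced path and a fifth vertex $v$: the bull has $v$ adjacent exactly to $b,c$; the gem has $v$ adjacent to all of $a,b,c,d$; the co-gem has $v$ isolated. -}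

module Defs where

open import Data.Nat using (ℕ; zero; suc; _+_; _<_)
open import Data.Bool using (Bool; true; false; _∧_; _∨_; _xor_; not; if_then_else_)
open import Data.Fin using (Fin; zero; suc)
open import Data.Fin.Properties using (_≟_)
open import Data.List using (List; []; _∷_)
open import Data.Bool.ListAction using (any)
open import Data.Product using (Σ; ∃; ∃-syntax; _×_; _,_)
open import Data.Sum using (_⊎_)
open import Relation.Nullary using (¬_; does)
open import Relation.Binary.PropositionalEquality using (_≡_; _≢_)
open import Function.Bundles using (_↔_; Inverse)

record Graph (n : ℕ) : Set where
  field
    adj    : Fin n → Fin n → Bool
    sym    : ∀ u v → adj u v ≡ adj v u
    irrefl : ∀ u → adj u u ≡ false
open Graph public

VSet : ℕ → Set
VSet n = Fin n → Bool

compl : ∀ {n} → VSet n → VSet n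
compl A x = not (A x)

count : ∀ {n} → (Fin n → Bool) → ℕ
count {zero}  p = 0
count {suc n} p = (if p zero then 1 else 0) + count (λ i → p (suc i))

-- the flip G ⊕ (A,B) on adjacency functions: toggle adjacency of distinct u,v
-- exactly when (u,v) ∈ (A × B) ∪ (B × A)
flip : ∀ {n} → (Fin n → Fin n → Bool) → VSet n → VSet n → Fin n → Fin n → Bool
flip adj A B u v =
  if does (u ≟ v) then adj u v
  else (adj u v xor ((A u ∧ B v) ∨ (B u ∧ A v)))

-- apply the flip only if the Boolean flag is set (membership of the flip in 𝒫)
flipIf : ∀ {n} → Bool → (Fin n → Fin n → Bool) → VSet n → VSet n → Fin n → Fin n → Bool
flipIf true  adj A B = flip adj A B
flipIf false adj A B = adj

Isolated : ∀ {n} → (Fin n → Fin n → Bool) → Fin n → Set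
Isolated adj v = ∀ u → u ≢ v → adj v u ≡ false

degree : ∀ {n} → Graph n → Fin n → ℕ
degree G v = count (λ u → adj G v u)

edgesAdj : List (Fin 5 × Fin 5) → Fin 5 → Fin 5 → Bool
edgesAdj es u v = any (λ { (x , y) → (does (x ≟ u) ∧ does (y ≟ v)) ∨ (does (x ≟ v) ∧ does (y ≟ u)) }) es

v0 v1 v2 v3 v4 : Fin 5
v0 = zero
v1 = suc zero
v2 = suc (suc zero)
v3 = suc (suc (suc zero))
v4 = suc (suc (suc (suc zero)))

C5 : Fin 5 → Fin 5 → Bool
C5 = edgesAdj ((v0 , v1) ∷ (v1 , v2) ∷ (v2 , v3) ∷ (v3 , v4) ∷ (v4 , v0) ∷ [])

-- induced path abcd = 0123 and fifth vertex v = 4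
-- bull: v adjacent exactly to b, c
bull : Fin 5 → Fin 5 → Bool
bull = edgesAdj ((v0 , v1) ∷ (v1 , v2) ∷ (v2 , v3) ∷ (v4 , v1) ∷ (v4 , v2) ∷ [])

gem : Fin 5 → Fin 5 → Bool
gem = edgesAdj ((v0 , v1) ∷ (v1 , v2) ∷ (v2 , v3) ∷ (v4 , v0) ∷ (v4 , v1) ∷ (v4 , v2) ∷ (v4 , v3) ∷ [])

-- co-gem: v isolated
coGem : Fin 5 → Fin 5 → Bool
coGem = edgesAdj ((v0 , v1) ∷ (v1 , v2) ∷ (v2 , v3) ∷ [])

IsoTo : ∀ {n} → Graph n → (Fin 5 → Fin 5 → Bool) → Set
IsoTo {n} G K =
  Σ (Fin n ↔ Fin 5) λ f → ∀ u v → adj G u v ≡ K (Inverse.to f u) (Inverse.to f v)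

ConsistsOf : ∀ {n} → VSet n → Fin n → Fin n → Set
ConsistsOf A x y = ∀ z → (A z ≡ true → z ≡ x ⊎ z ≡ y) × (z ≡ x ⊎ z ≡ y → A z ≡ true)

{-# OPTIONS --safe #-}
-- Isolated vertices, vertex counts, degrees and the flips along a partition are all
-- preserved by relabelling the vertices, so an isomorphism to one of the four
-- five-vertex graphs reduces the statement to that graph together with a subset of
-- Fin 5 and the two flip flags. There are only 2⁵ · 2² such choices per graph, and
-- the resulting proposition is decided by evaluation.
module Submission where

open import Defs hiding (sym)
open import Data.Nat using (ℕ; zero; suc; _+_; _<_; _<?_)
open import Data.Nat.Properties using (+-0-commutativeMonoid) renaming (_≟_ to _≟ℕ_)
open import Data.Bool using (Bool; true; false; not; if_then_else_)
open import Data.Bool.Properties using () renaming (_≟_ to _≟ᵇ_)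
open import Data.Fin as Fin using (Fin)
open import Data.Fin.Properties using (_≟_; all?; any?)
open import Data.Fin.Permutation using (Permutation; _⟨$⟩ʳ_; _⟨$⟩ˡ_; inverseˡ; inverseʳ)
open import Data.Fin.Subset using (Subset)
open import Data.Vec using ([]; _∷_; lookup; tabulate)
open import Data.Vec.Properties using (lookup∘tabulate)
open import Data.Product using (∃-syntax; _×_; _,_; proj₁; proj₂)
open import Data.Sum as Sum using (_⊎_; inj₁; inj₂)
open import Data.Empty using (⊥-elim)
open import Function using (_∘_; mk⇔)
open import Level using (Level)
open import Relation.Nullary using (¬_; Dec)
open import Relation.Nullary.Decidable
  using (_×-dec_; _⊎-dec_; _→-dec_; ¬?; map′; from-yes; does-⇔)
open import Relation.Unary using (Pred; Decidable)
open import Relation.Binary.PropositionalEquality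
  using (_≡_; _≢_; _≗_; refl; sym; trans; cong; cong₂; subst₂; module ≡-Reasoning)
open import Algebra.Properties.CommutativeMonoid.Sum +-0-commutativeMonoid
  using (sum; sum-cong-≗; sum-permute)

private
  variable
    ℓ : Level
    m n : ℕ

flipSides : (Fin n → Fin n → Bool) → VSet n → Bool → Bool → Fin n → Fin n → Bool
flipSides a A pA pB = flipIf pA (flipIf pB a (compl A) (compl A)) A A

TwoIsolated : (Fin n → Fin n → Bool) → Set
TwoIsolated a = ∃[ x ] ∃[ y ] (x ≢ y × Isolated a x × Isolated a y)

ExactlyTwoIsolated : (Fin n → Fin n → Bool) → Set
ExactlyTwoIsolated a =
  ∃[ x ] ∃[ y ] (x ≢ y × Isolated a x × Isolated a y × (∀ z → Isolated a z → z ≡ x ⊎ z ≡ y))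

Hypotheses : (Fin n → Fin n → Bool) → VSet n → Bool → Bool → Set
Hypotheses a A pA pB = count A < count (compl A) × TwoIsolated (flipSides a A pA pB)

IsolatedAndLeaf : (Fin n → Fin n → Bool) → VSet n → Set
IsolatedAndLeaf a A = ∃[ w ] ∃[ u ] (Isolated a w × count (a u) ≡ 1 × ConsistsOf A w u)

LeafAndNeighbour : (Fin n → Fin n → Bool) → VSet n → Set
LeafAndNeighbour a A = ∃[ u ] ∃[ w ] (count (a u) ≡ 1 × a u w ≡ true × ConsistsOf A u w)

Outcome : (Fin n → Fin n → Bool) → VSet n → Bool → Bool → Set
Outcome a A pA pB =
  (IsolatedAndLeaf a A × pA ≡ false × pB ≡ true ⊎ LeafAndNeighbour a A × pA ≡ true × pB ≡ false)
  × ExactlyTwoIsolated (flipSides a A pA pB)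

count≡sum : (p : Fin n → Bool) → count p ≡ sum (λ i → if p i then 1 else 0)
count≡sum {zero}  p = refl
count≡sum {suc n} p = cong ((if p Fin.zero then 1 else 0) +_) (count≡sum (p ∘ Fin.suc))

count-permute : (π : Permutation m n) {p : Fin m → Bool} {q : Fin n → Bool} →
                p ≗ q ∘ (π ⟨$⟩ʳ_) → count p ≡ count q
count-permute π {p} {q} p≗q = begin
  count p                                       ≡⟨ count≡sum p ⟩
  sum (λ i → if p i then 1 else 0)               ≡⟨ sum-cong-≗ (cong (λ b → if b then 1 else 0) ∘ p≗q) ⟩
  sum (λ i → if q (π ⟨$⟩ʳ i) then 1 else 0)      ≡⟨ sum-permute (λ j → if q j then 1 else 0) π ⟨
  sum (λ j → if q j then 1 else 0)               ≡⟨ count≡sum q ⟨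
  count q                                       ∎
  where open ≡-Reasoning

module _ (π : Permutation m n) where

  private
    σ : Fin m → Fin n
    σ = π ⟨$⟩ʳ_

    τ : Fin n → Fin m
    τ = π ⟨$⟩ˡ_

    σ-injective : ∀ {u v} → σ u ≡ σ v → u ≡ v
    σ-injective e = trans (sym (inverseˡ π)) (trans (cong τ e) (inverseˡ π))

    σ≡⇒≡τ : ∀ {z x} → σ z ≡ x → z ≡ τ x
    σ≡⇒≡τ e = trans (sym (inverseˡ π)) (cong τ e)

    ≡τ⇒σ≡ : ∀ {z x} → z ≡ τ x → σ z ≡ x
    ≡τ⇒σ≡ e = trans (cong σ e) (inverseʳ π)

    τ≡⇒≡σ : ∀ {z x} → τ z ≡ x → z ≡ σ x
    τ≡⇒≡σ e = trans (sym (inverseʳ π)) (cong σ e)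

    τ-injective : ∀ {u v} → τ u ≡ τ v → u ≡ v
    τ-injective e = trans (τ≡⇒≡σ e) (inverseʳ π)

  Relabels : (Fin m → Fin m → Bool) → (Fin n → Fin n → Bool) → Set
  Relabels a b = ∀ u v → a u v ≡ b (σ u) (σ v)

  module _ {a : Fin m → Fin m → Bool} {b : Fin n → Fin n → Bool} (r : Relabels a b) where

    isolated-to : ∀ {x} → Isolated a x → Isolated b (σ x)
    isolated-to {x} iso-x u u≢σx = begin
      b (σ x) u             ≡⟨ cong (b (σ x)) (inverseʳ π) ⟨
      b (σ x) (σ (τ u))     ≡⟨ r x (τ u) ⟨
      a x (τ u)             ≡⟨ iso-x (τ u) (u≢σx ∘ τ≡⇒≡σ) ⟩
      false                 ∎
      where open ≡-Reasoning

    isolated-from : ∀ {x} → Isolated b x → Isolated a (τ x)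
    isolated-from {x} iso-x u u≢τx = begin
      a (τ x) u             ≡⟨ r (τ x) u ⟩
      b (σ (τ x)) (σ u)     ≡⟨ cong (λ y → b y (σ u)) (inverseʳ π) ⟩
      b x (σ u)             ≡⟨ iso-x (σ u) (u≢τx ∘ σ≡⇒≡τ) ⟩
      false                 ∎
      where open ≡-Reasoning

    adjacent-from : ∀ {u w} → b u w ≡ true → a (τ u) (τ w) ≡ true
    adjacent-from buw = trans (r _ _) (trans (cong₂ b (inverseʳ π) (inverseʳ π)) buw)

    degree-from : ∀ {u k} → count (b u) ≡ k → count (a (τ u)) ≡ k
    degree-from {u} deg = trans (count-permute π (r (τ u))) (trans (cong (count ∘ b) (inverseʳ π)) deg)

    twoIsolated-to : TwoIsolated a → TwoIsolated b
    twoIsolated-to (x , y , x≢y , iso-x , iso-y) =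
      σ x , σ y , x≢y ∘ σ-injective , isolated-to iso-x , isolated-to iso-y

    exactlyTwoIsolated-from : ExactlyTwoIsolated b → ExactlyTwoIsolated a
    exactlyTwoIsolated-from (x , y , x≢y , iso-x , iso-y , only) =
      τ x , τ y , x≢y ∘ τ-injective , isolated-from iso-x , isolated-from iso-y ,
      λ z iso-z → Sum.map σ≡⇒≡τ σ≡⇒≡τ (only (σ z) (isolated-to iso-z))

  complement-relabels : {A : VSet m} {A′ : VSet n} → A ≗ A′ ∘ σ → compl A ≗ compl A′ ∘ σ
  complement-relabels A≗ = cong not ∘ A≗

  consistsOf-from : {A : VSet m} {A′ : VSet n} → A ≗ A′ ∘ σ →
                    ∀ {x y} → ConsistsOf A′ x y → ConsistsOf A (τ x) (τ y)
  consistsOf-from A≗ c z =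
    (λ Az → Sum.map σ≡⇒≡τ σ≡⇒≡τ (inside (trans (sym (A≗ z)) Az))) ,
    (λ z∈ → trans (A≗ z) (outside (Sum.map ≡τ⇒σ≡ ≡τ⇒σ≡ z∈)))
    where
      inside  = proj₁ (c (σ z))
      outside = proj₂ (c (σ z))

  flip-relabels : ∀ {a b} {A B : VSet m} {A′ B′ : VSet n} → Relabels a b →
                  A ≗ A′ ∘ σ → B ≗ B′ ∘ σ → Relabels (flip a A B) (flip b A′ B′)
  flip-relabels r A≗ B≗ u v
    rewrite does-⇔ (mk⇔ (cong σ) σ-injective) (u ≟ v) (σ u ≟ σ v)
          | r u v | A≗ u | A≗ v | B≗ u | B≗ v = refl

  flipIf-relabels : ∀ p {a b} {A B : VSet m} {A′ B′ : VSet n} → Relabels a b →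
                    A ≗ A′ ∘ σ → B ≗ B′ ∘ σ → Relabels (flipIf p a A B) (flipIf p b A′ B′)
  flipIf-relabels true {b = b} {A′ = A′} {B′} = flip-relabels {b = b} {A′ = A′} {B′ = B′}
  flipIf-relabels false r _ _ = r

  flipSides-relabels : ∀ {a b} {A : VSet m} {A′ : VSet n} pA pB → Relabels a b →
                       A ≗ A′ ∘ σ → Relabels (flipSides a A pA pB) (flipSides b A′ pA pB)
  flipSides-relabels {A′ = A′} pA pB r A≗ =
    flipIf-relabels pA (flipIf-relabels pB r A≗ᶜ A≗ᶜ) A≗ A≗
    where
      A≗ᶜ = complement-relabels {A′ = A′} A≗

  relabelledSubset : VSet m → Subset n
  relabelledSubset A = tabulate (A ∘ τ)

  relabelledSubset-≗ : (A : VSet m) → A ≗ lookup (relabelledSubset A) ∘ σ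
  relabelledSubset-≗ A u = trans (cong A (sym (inverseˡ π))) (sym (lookup∘tabulate (A ∘ τ) (σ u)))

  module _ {a : Fin m → Fin m → Bool} (b : Fin n → Fin n → Bool) (r : Relabels a b) (A : VSet m) where

    private
      A′ : VSet n
      A′ = lookup (relabelledSubset A)

      A≗ : A ≗ A′ ∘ σ
      A≗ = relabelledSubset-≗ A

    hypotheses-to : ∀ pA pB → Hypotheses a A pA pB → Hypotheses b A′ pA pB
    hypotheses-to pA pB (lt , two) =
      subst₂ _<_ (count-permute π A≗) (count-permute π (complement-relabels {A′ = A′} A≗)) lt ,
      twoIsolated-to (flipSides-relabels pA pB r A≗) two

    outcome-from : ∀ pA pB → Outcome b A′ pA pB → Outcome a A pA pB
    outcome-from pA pB (cases , exact) =
      Sum.map isolatedAndLeaf-from leafAndNeighbour-from cases ,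
      exactlyTwoIsolated-from (flipSides-relabels pA pB r A≗) exact
      where
        isolatedAndLeaf-from : ∀ {P} → IsolatedAndLeaf b A′ × P → IsolatedAndLeaf a A × P
        isolatedAndLeaf-from ((w , u , iso-w , deg-u , c) , p) =
          (τ w , τ u , isolated-from r iso-w , degree-from r deg-u , consistsOf-from A≗ c) , p

        leafAndNeighbour-from : ∀ {P} → LeafAndNeighbour b A′ × P → LeafAndNeighbour a A × P
        leafAndNeighbour-from ((u , w , deg-u , uw , c) , p) =
          (τ u , τ w , degree-from r deg-u , adjacent-from r uw , consistsOf-from A≗ c) , p

allBool? : {P : Pred Bool ℓ} → Decidable P → Dec (∀ b → P b)
allBool? P? = map′ (λ (t , f) → λ { true → t ; false → f }) (λ h → h true , h false)
                   (P? true ×-dec P? false)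

allSubset? : {P : Pred (Subset n) ℓ} → Decidable P → Dec (∀ s → P s)
allSubset? {n = zero}  P? = map′ (λ p → λ { [] → p }) (λ h → h []) (P? [])
allSubset? {n = suc n} P? =
  map′ (λ (t , f) → λ { (true ∷ s) → t s ; (false ∷ s) → f s }) (λ h → h ∘ (true ∷_) , h ∘ (false ∷_))
       (allSubset? (P? ∘ (true ∷_)) ×-dec allSubset? (P? ∘ (false ∷_)))

isolated? : (a : Fin n → Fin n → Bool) → Decidable (Isolated a)
isolated? a v = all? λ u → ¬? (u ≟ v) →-dec a v u ≟ᵇ false

twoIsolated? : (a : Fin n → Fin n → Bool) → Dec (TwoIsolated a)
twoIsolated? a = any? λ x → any? λ y → ¬? (x ≟ y) ×-dec isolated? a x ×-dec isolated? a y

exactlyTwoIsolated? : (a : Fin n → Fin n → Bool) → Dec (ExactlyTwoIsolated a)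
exactlyTwoIsolated? a = any? λ x → any? λ y →
  ¬? (x ≟ y) ×-dec isolated? a x ×-dec isolated? a y ×-dec
  all? (λ z → isolated? a z →-dec (z ≟ x ⊎-dec z ≟ y))

consistsOf? : (A : VSet n) → ∀ x y → Dec (ConsistsOf A x y)
consistsOf? A x y = all? λ z →
  (A z ≟ᵇ true →-dec (z ≟ x ⊎-dec z ≟ y)) ×-dec ((z ≟ x ⊎-dec z ≟ y) →-dec A z ≟ᵇ true)

hypotheses? : ∀ a (A : VSet n) pA pB → Dec (Hypotheses a A pA pB)
hypotheses? a A pA pB = count A <? count (compl A) ×-dec twoIsolated? (flipSides a A pA pB)

outcome? : ∀ a (A : VSet n) pA pB → Dec (Outcome a A pA pB)
outcome? a A pA pB =
  (  (isolatedAndLeaf? ×-dec pA ≟ᵇ false ×-dec pB ≟ᵇ true)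
  ⊎-dec (leafAndNeighbour? ×-dec pA ≟ᵇ true ×-dec pB ≟ᵇ false))
  ×-dec exactlyTwoIsolated? (flipSides a A pA pB)
  where
    isolatedAndLeaf? = any? λ w → any? λ u →
      isolated? a w ×-dec count (a u) ≟ℕ 1 ×-dec consistsOf? A w u
    leafAndNeighbour? = any? λ u → any? λ w →
      count (a u) ≟ℕ 1 ×-dec a u w ≟ᵇ true ×-dec consistsOf? A u w

NeverTwoIsolated : (Fin 5 → Fin 5 → Bool) → Set
NeverTwoIsolated K = ∀ (s : Subset 5) pA pB → ¬ Hypotheses K (lookup s) pA pB

neverTwoIsolated? : ∀ K → Dec (NeverTwoIsolated K)
neverTwoIsolated? K = allSubset? λ s → allBool? λ pA → allBool? λ pB →
  ¬? (hypotheses? K (lookup s) pA pB)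

C5-neverTwoIsolated : NeverTwoIsolated C5
C5-neverTwoIsolated = from-yes (neverTwoIsolated? C5)

bull-neverTwoIsolated : NeverTwoIsolated bull
bull-neverTwoIsolated = from-yes (neverTwoIsolated? bull)

gem-neverTwoIsolated : NeverTwoIsolated gem
gem-neverTwoIsolated = from-yes (neverTwoIsolated? gem)

coGem-outcome : ∀ (s : Subset 5) pA pB → Hypotheses coGem (lookup s) pA pB → Outcome coGem (lookup s) pA pB
coGem-outcome = from-yes
  (allSubset? λ s → allBool? λ pA → allBool? λ pB →
     hypotheses? coGem (lookup s) pA pB →-dec outcome? coGem (lookup s) pA pB)

lemma3p2 : ∀ {n} (G : Graph n) (A : VSet n) (pA pB : Bool)
    → (IsoTo G C5 ⊎ IsoTo G bull ⊎ IsoTo G gem ⊎ IsoTo G coGem)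
    → count A < count (compl A)
    → let H = flipIf pA (flipIf pB (adj G) (compl A) (compl A)) A A in
      (∃[ x ] ∃[ y ] (x ≢ y × Isolated H x × Isolated H y))
    → ((IsoTo G coGem
          × (∃[ w ] ∃[ u ] (Isolated (adj G) w × degree G u ≡ 1 × ConsistsOf A w u))
          × pA ≡ false × pB ≡ true)
       ⊎ (IsoTo G coGem
          × (∃[ u ] ∃[ w ] (degree G u ≡ 1 × adj G u w ≡ true × ConsistsOf A u w))
          × pA ≡ true × pB ≡ false))
      × (∃[ x ] ∃[ y ] (x ≢ y × Isolated H x × Isolated H y
                        × (∀ z → Isolated H z → z ≡ x ⊎ z ≡ y)))
lemma3p2 G A pA pB (inj₁ (π , r)) lt two =
  ⊥-elim (C5-neverTwoIsolated (relabelledSubset π A) pA pB (hypotheses-to π C5 r A pA pB (lt , two)))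
lemma3p2 G A pA pB (inj₂ (inj₁ (π , r))) lt two =
  ⊥-elim (bull-neverTwoIsolated (relabelledSubset π A) pA pB (hypotheses-to π bull r A pA pB (lt , two)))
lemma3p2 G A pA pB (inj₂ (inj₂ (inj₁ (π , r)))) lt two =
  ⊥-elim (gem-neverTwoIsolated (relabelledSubset π A) pA pB (hypotheses-to π gem r A pA pB (lt , two)))
lemma3p2 G A pA pB (inj₂ (inj₂ (inj₂ iso@(π , r)))) lt two =
  let reduced       = hypotheses-to π coGem r A pA pB (lt , two)
      cases , exact = outcome-from π coGem r A pA pB (coGem-outcome (relabelledSubset π A) pA pB reduced)
  in Sum.map (iso ,_) (iso ,_) cases , exact
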